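{- For integers $N\ge r\ge0$, the Koornwinder moment at $q=\xi=1$ of the partition $(N-r,0,\dots,0)$ with exactly $r$ zeros satisfies $$K_{(N-r,0,\dots,0)}=S^{N-r}\binom Nr\prod_{i=r}^{N-1}(x+i)=\frac{1}{(\alpha\beta-\gamma\delta)^{N-r}}\binom Nr\prod_{i=r}^{N-1}\big(\alpha+\beta+\gamma+\delta+i(\alpha+\gamma)(\beta+\delta)\big).$$
   Context: Let $\alpha,\beta,\gamma,\delta$ be positive reals with $\alpha\beta\ne\gamma\delta$ (or generic parameters). Put $x=\frac{\alpha+\beta+\gamma+\delta}{(\alpha+\gamma)(\beta+\delta)}$ and $S=\frac{(\alpha+\gamma)(\beta+\delta)}{\alpha\beta-\gamma\delta}$. Let $\mathcal D,\mathcal E$ be infinite tridiagonal matrices indexed by $\{0,1,\dots\}$ with entries $\mathcal D_{n,n}=\frac{\alpha+\delta+n(\alpha\beta+2\alpha\delta+\gamma\delta)}{(\alpha+\gamma)(\beta+\delta)}$, $\mathcal E_{n,n}=\frac{\beta+\gamma+n(\alpha\beta+2\beta\gamma+\gamma\delta)}{(\alpha+\gamma)(\beta+\delta)}$, $\mathcal D_{n,n+1}=\frac{\alpha}{\alpha+\gamma}[(n+1)(x+n)]^{1/2}$, $\mathcal E_{n,n+1}=\frac{\gamma}{\alpha+\gamma}[(n+1)(x+n)]^{1/2}$, $\mathcal D_{n+1,n}=\frac{\delta}{\beta+\delta}[(n+1)(x+n)]^{1/2}$, $\mathcal E_{n+1,n}=\frac{\beta}{\beta+\delta}[(n+1)(x+n)]^{1/2}$,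 all other entries $0$. With $\langle W|=(1,0,0,\dots)$ and $|V\rangle=\langle W|^T$, set $Z_N=S^N\langle W|(\mathcal D+\mathcal E)^N|V\rangle$ (the partition function at $q=\xi=1$). For an integer sequence $\mu=(\mu_1,\dots,\mu_m)$ with $\mu_i+m-i\ge0$, $K_\mu=\frac{\det(Z_{\mu_i+m-i+m-j})_{i,j=1}^m}{\det(Z_{2m-i-j})_{i,j=1}^m}$. -}

module Defs where

open import Level using (Level; _⊔_) renaming (suc to lsuc)
open import Algebra.Bundles using (CommutativeRing)
open import Relation.Binary.Structures using (IsStrictTotalOrder)
open import Relation.Nullary using (¬_)
open import Data.Nat as ℕ using (ℕ; zero; suc; _∸_)
open import Data.Nat.Combinatorics using (_C_)
open import Data.Fin using (Fin; toℕ; punchIn) renaming (zero to fzero; suc to fsuc)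

-- An ordered field in which every nonnegative element has a square root
-- (a Euclidean ordered field; ℝ is the intended model).
record OrderedSqrtField c ℓ : Set (lsuc (c ⊔ ℓ)) where
  field
    commutativeRing : CommutativeRing c ℓ
  open CommutativeRing commutativeRing public
  infix 4 _<_
  infix 8 _⁻¹
  field
    _<_                 : Carrier → Carrier → Set ℓ
    <-isStrictTotalOrder : IsStrictTotalOrder _≈_ _<_
    +-monoˡ-<           : ∀ {x y} z → x < y → x + z < y + z
    *-pos               : ∀ {x y} → 0# < x → 0# < y → 0# < x * y
    0<1                 : 0# < 1#
    _⁻¹                 : Carrier → Carrier
    ⁻¹-inverse          : ∀ {x} → ¬ (x ≈ 0#) → x * x ⁻¹ ≈ 1#
    √                   : Carrier → Carrier
    √-nonneg            : ∀ {x} → ¬ (x < 0#) → ¬ (√ x < 0#)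
    √-square            : ∀ {x} → ¬ (x < 0#) → √ x * √ x ≈ x

module Koornwinder {c ℓ} (F : OrderedSqrtField c ℓ)
                   (α β γ δ : OrderedSqrtField.Carrier F) where
  open OrderedSqrtField F

  ι : ℕ → Carrier
  ι zero    = 0#
  ι (suc n) = 1# + ι n

  infixr 8 _^'_
  _^'_ : Carrier → ℕ → Carrier
  a ^' zero  = 1#
  a ^' suc n = a * a ^' n

  prodFrom : ℕ → ℕ → (ℕ → Carrier) → Carrier
  prodFrom a zero    f = 1#
  prodFrom a (suc n) f = f a * prodFrom (suc a) n f

  prodRange : ℕ → ℕ → (ℕ → Carrier) → Carrier
  prodRange a b f = prodFrom a (b ∸ a) f

  sumUpTo : ℕ → (ℕ → Carrier) → Carrier
  sumUpTo zero    f = f 0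
  sumUpTo (suc n) f = sumUpTo n f + f (suc n)

  sumFin : (m : ℕ) → (Fin m → Carrier) → Carrier
  sumFin zero    f = 0#
  sumFin (suc m) f = f fzero + sumFin m (λ j → f (fsuc j))

  det : (m : ℕ) → (Fin m → Fin m → Carrier) → Carrier
  det zero    A = 1#
  det (suc m) A = sumFin (suc m) λ j →
    ((- 1#) ^' toℕ j) * (A fzero j * det m (λ r k → A (fsuc r) (punchIn j k)))

  x : Carrier
  x = (α + β + γ + δ) * ((α + γ) * (β + δ)) ⁻¹

  S : Carrier
  S = ((α + γ) * (β + δ)) * (α * β - γ * δ) ⁻¹

  Mat : Set c
  Mat = ℕ → ℕ → Carrier

  -- tridiagonal matrix with diagonal d n = M(n,n), upper u n = M(n,n+1),
  -- lower l n = M(n+1,n), all other entries 0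
  tri : (ℕ → Carrier) → (ℕ → Carrier) → (ℕ → Carrier) → Mat
  tri d u l zero          zero          = d 0
  tri d u l zero          (suc zero)    = u 0
  tri d u l (suc zero)    zero          = l 0
  tri d u l zero          (suc (suc m)) = 0#
  tri d u l (suc (suc n)) zero          = 0#
  tri d u l (suc n)       (suc m)       = tri (λ k → d (suc k)) (λ k → u (suc k)) (λ k → l (suc k)) n m

  den : Carrier
  den = (α + γ) * (β + δ)

  off : ℕ → Carrier
  off n = √ (ι (suc n) * (x + ι n))

  𝒟 : Mat
  𝒟 = tri (λ n → (α + δ + ι n * (α * β + ι 2 * α * δ + γ * δ)) * den ⁻¹)
          (λ n → α * (α + γ) ⁻¹ * off n)
          (λ n → δ * (β + δ) ⁻¹ * off n)

  ℰ : Mat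
  ℰ = tri (λ n → (β + γ + ι n * (α * β + ι 2 * β * γ + γ * δ)) * den ⁻¹)
          (λ n → γ * (α + γ) ⁻¹ * off n)
          (λ n → β * (β + δ) ⁻¹ * off n)

  _⊕_ : Mat → Mat → Mat
  (A ⊕ B) i j = A i j + B i j

  -- product A·B of infinite matrices where B(j,k) = 0 for j > k+1
  -- (true for tridiagonal B), so (A·B)(i,k) = Σ_{j=0}^{k+1} A(i,j) B(j,k)
  _⊙_ : Mat → Mat → Mat
  (A ⊙ B) i k = sumUpTo (suc k) λ j → A i j * B j k

  idMat : Mat
  idMat = tri (λ _ → 1#) (λ _ → 0#) (λ _ → 0#)

  pow : Mat → ℕ → Mat
  pow A zero    = idMat
  pow A (suc N) = pow A N ⊙ A

  -- Z_N = S^N ⟨W|(𝒟+ℰ)^N|V⟩ with ⟨W| = (1,0,0,…), |V⟩ = ⟨W|ᵀ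
  Z : ℕ → Carrier
  Z N = S ^' N * pow (𝒟 ⊕ ℰ) N 0 0

  -- K_μ for μ = (μ₁,…,μ_m) with nonnegative parts (Fin m is 0-indexed:
  -- 1-indexed i corresponds to toℕ i + 1, so m - i = m ∸ suc (toℕ i))
  K : (m : ℕ) → (Fin m → ℕ) → Carrier
  K m μ = det m (λ i j → Z (μ i ℕ.+ (m ∸ suc (toℕ i)) ℕ.+ (m ∸ suc (toℕ j))))
        * det m (λ i j → Z ((m ∸ suc (toℕ i)) ℕ.+ (m ∸ suc (toℕ j)))) ⁻¹

  hook : (N r : ℕ) → Fin (suc r) → ℕ
  hook N r fzero    = N ∸ r
  hook N r (fsuc _) = 0

-- Conjugating the tridiagonal matrix 𝒟 + ℰ by the diagonal matrix of partial products of
-- its off-diagonal entries gives a tridiagonal matrix whose N-th power has first row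
-- (N ↓ k) (x)_N, so Z_N = S^N (x)_N with (x)_N the rising factorial.
-- Let f n be the Hankel determinant det (Z_{2r-i-j}) with its first row replaced by
-- (Z_{n+r-j})_j, so that K is f N / f r.  Expanding along that row, f n = Z_n g n where
-- g n = ∑_{d ≤ r} a_d (x + n)_d is a polynomial of degree ≤ r in n.  For n < r the first row
-- repeats a later one, so g vanishes at 0, …, r - 1 and therefore g n = (n choose r) r! a_r.
-- Hence K = (Z_N / Z_r) (N choose r), which is the claim; f r ≠ 0 by induction on r, because
-- a_r is S^r times the previous Hankel determinant.

module Submission where

open import Defs
open import Algebra.Bundles using (CommutativeRing)
open import Data.Nat as ℕ using (ℕ; zero; suc; _∸_; _!)
open import Data.Integer as ℤ using (ℤ; +_; -[1+_]; _⊖_; _◃_)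
import Data.Sign as Sign
import Data.Integer.Properties as ℤ
import Data.Nat.Properties as ℕ
open import Data.Maybe using (Maybe; just; nothing)
open import Data.Fin using (Fin; toℕ; punchIn) renaming (zero to fzero; suc to fsuc)
open import Data.Nat.Combinatorics using (_C_; nCk+nC[k+1]≡[n+1]C[k+1]; nCn≡1)
open import Relation.Nullary using (yes; no; ¬_; contradiction)
open import Relation.Binary.Definitions using (tri<; tri≈; tri>)
open import Relation.Binary.Structures using (IsStrictTotalOrder)
import Relation.Binary.PropositionalEquality as P
import Algebra.Solver.Ring.AlmostCommutativeRing as ACR
import Data.Nat

-- The ring solver with integer coefficients, so that constants cancel in any commutative
-- ring; with the optimised _×_, the coefficient + 1 is interpreted as 1# itself.
module IntegerCoefficientSolver {c ℓ} (R : CommutativeRing c ℓ) where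
  open CommutativeRing R
  open import Algebra.Properties.Ring ring
    using (-0#≈0#; -‿involutive; -‿+-comm; -‿distribˡ-*; -‿distribʳ-*)
  open import Algebra.Properties.Semiring.Mult.TCOptimised semiring using (_×_; ×-homo-+; ×1-homo-*)
  open import Algebra.Properties.CommutativeSemigroup +-commutativeSemigroup using (interchange)
  open import Relation.Binary.Reasoning.Setoid setoid

  ⟦_⟧ : ℤ → Carrier
  ⟦ + n ⟧      = n × 1#
  ⟦ -[1+ n ] ⟧ = - (suc n × 1#)

  ⟦⟧-cong : ∀ {i j} → i P.≡ j → ⟦ i ⟧ ≈ ⟦ j ⟧
  ⟦⟧-cong P.refl = refl

  ⟦-⟧ : ∀ i → ⟦ ℤ.- i ⟧ ≈ - ⟦ i ⟧
  ⟦-⟧ (+ zero)   = sym -0#≈0#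
  ⟦-⟧ (+ suc n)  = refl
  ⟦-⟧ -[1+ n ]   = sym (-‿involutive _)

  ⟦⊖⟧ : ∀ m n → ⟦ m ⊖ n ⟧ ≈ m × 1# - n × 1#
  ⟦⊖⟧ m       zero    = sym (trans (+-congˡ -0#≈0#) (+-identityʳ _))
  ⟦⊖⟧ zero    (suc n) = sym (+-identityˡ _)
  ⟦⊖⟧ (suc m) (suc n) = begin
    ⟦ suc m ⊖ suc n ⟧                  ≈⟨ ⟦⟧-cong (ℤ.[1+m]⊖[1+n]≡m⊖n m n) ⟩
    ⟦ m ⊖ n ⟧                          ≈⟨ ⟦⊖⟧ m n ⟩
    m × 1# - n × 1#                    ≈⟨ +-identityˡ _ ⟨
    0# + (m × 1# - n × 1#)             ≈⟨ +-congʳ (-‿inverseʳ 1#) ⟨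
    (1# - 1#) + (m × 1# - n × 1#)      ≈⟨ interchange 1# (m × 1#) (- 1#) (- (n × 1#)) ⟨
    (1# + m × 1#) + (- 1# - n × 1#)    ≈⟨ +-congˡ (-‿+-comm 1# (n × 1#)) ⟩
    (1# + m × 1#) - (1# + n × 1#)      ≈⟨ +-cong (×-homo-+ 1# 1 m) (-‿cong (×-homo-+ 1# 1 n)) ⟨
    suc m × 1# - suc n × 1#            ∎

  ⟦+⟧ : ∀ i j → ⟦ i ℤ.+ j ⟧ ≈ ⟦ i ⟧ + ⟦ j ⟧
  ⟦+⟧ (+ m)      (+ n)      = ×-homo-+ 1# m n
  ⟦+⟧ (+ m)      -[1+ n ]   = ⟦⊖⟧ m (suc n)
  ⟦+⟧ -[1+ m ]   (+ n)      = trans (⟦⊖⟧ n (suc m)) (+-comm _ _)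
  ⟦+⟧ -[1+ m ]   -[1+ n ]   = begin
    - (suc (suc (m ℕ.+ n)) × 1#)       ≈⟨ -‿cong (⟦⟧-cong {+ _} (P.cong (λ k → + suc k) (ℕ.+-suc m n))) ⟨
    - ((suc m ℕ.+ suc n) × 1#)         ≈⟨ -‿cong (×-homo-+ 1# (suc m) (suc n)) ⟩
    - (suc m × 1# + suc n × 1#)        ≈⟨ -‿+-comm _ _ ⟨
    - (suc m × 1#) - suc n × 1#        ∎

  ⟦-◃⟧ : ∀ n → ⟦ Sign.- ◃ n ⟧ ≈ - (n × 1#)
  ⟦-◃⟧ n = trans (⟦⟧-cong (ℤ.-◃n≡-n n)) (⟦-⟧ (+ n))

  ⟦*⟧ : ∀ i j → ⟦ i ℤ.* j ⟧ ≈ ⟦ i ⟧ * ⟦ j ⟧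
  ⟦*⟧ (+ m)      (+ n)      = trans (⟦⟧-cong (ℤ.+◃n≡+n (m ℕ.* n))) (×1-homo-* m n)
  ⟦*⟧ (+ m)      -[1+ n ]   =
    trans (⟦-◃⟧ (m ℕ.* suc n)) (trans (-‿cong (×1-homo-* m (suc n))) (-‿distribʳ-* _ _))
  ⟦*⟧ -[1+ m ]   (+ n)      =
    trans (⟦-◃⟧ (suc m ℕ.* n)) (trans (-‿cong (×1-homo-* (suc m) n)) (-‿distribˡ-* _ _))
  ⟦*⟧ -[1+ m ]   -[1+ n ]   = begin
    (suc m ℕ.* suc n) × 1#             ≈⟨ ×1-homo-* (suc m) (suc n) ⟩
    suc m × 1# * suc n × 1#            ≈⟨ -‿involutive _ ⟨
    - - (suc m × 1# * suc n × 1#)      ≈⟨ -‿cong (-‿distribʳ-* _ _) ⟩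
    - (suc m × 1# * - (suc n × 1#))    ≈⟨ -‿distribˡ-* _ _ ⟩
    - (suc m × 1#) * - (suc n × 1#)    ∎

  homomorphism : ℤ.+-*-rawRing ACR.-Raw-AlmostCommutative⟶ ACR.fromCommutativeRing R
  homomorphism = record
    { ⟦_⟧ = ⟦_⟧ ; +-homo = ⟦+⟧ ; *-homo = ⟦*⟧ ; -‿homo = ⟦-⟧ ; 0-homo = refl ; 1-homo = refl }

  coefficients≟ : ∀ i j → Maybe (⟦ i ⟧ ≈ ⟦ j ⟧)
  coefficients≟ i j with i ℤ.≟ j
  ... | yes i≡j = just (⟦⟧-cong i≡j)
  ... | no _    = nothing

  open import Algebra.Solver.Ring ℤ.+-*-rawRing (ACR.fromCommutativeRing R) homomorphism coefficients≟ public
    using (solve; _:=_; _:+_; _:*_; :-_; con)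

module FallingFactorial where
  open import Data.Nat using (_+_; _*_)
  open import Data.Nat.Tactic.RingSolver using (solve)
  open import Data.List using ([]; _∷_)
  open P using (_≡_; cong; cong₂; sym)
  open P.≡-Reasoning

  infixl 8 _↓_
  _↓_ : ℕ → ℕ → ℕ
  n     ↓ zero  = 1
  zero  ↓ suc k = 0
  suc n ↓ suc k = suc n * n ↓ k

  n↓1≡n : ∀ n → n ↓ 1 ≡ n
  n↓1≡n zero    = P.refl
  n↓1≡n (suc n) = cong suc (ℕ.*-identityʳ n)

  -- n ↓ (k + 1) = (n ∸ k) * n ↓ k, stated without truncated subtraction
  ↓-step : ∀ n k → n ↓ suc k + k * n ↓ k ≡ n * n ↓ k
  ↓-step zero    zero    = P.refl
  ↓-step zero    (suc k) = ℕ.*-zeroʳ k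
  ↓-step (suc n) zero    = ℕ.+-identityʳ _
  ↓-step (suc n) (suc k) = lift (↓-step n k)
    where
    lift : ∀ {p₁ p} → p₁ + k * p ≡ n * p → suc n * p₁ + suc k * (suc n * p) ≡ suc n * (suc n * p)
    lift {p₁} {p} h = begin
      suc n * p₁ + suc k * (suc n * p)      ≡⟨ solve (n ∷ k ∷ p ∷ p₁ ∷ []) ⟩
      suc n * (p₁ + k * p) + suc n * p      ≡⟨ cong (λ t → suc n * t + suc n * p) h ⟩
      suc n * (n * p) + suc n * p           ≡⟨ solve (n ∷ p ∷ []) ⟩
      suc n * (suc n * p)                   ∎

  ↓-suc : ∀ n k → suc n ↓ suc k ≡ n ↓ k * suc k + n ↓ suc k
  ↓-suc n k = lift (↓-step n k)
    where
    lift : ∀ {p₁ p} → p₁ + k * p ≡ n * p → suc n * p ≡ p * suc k + p₁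
    lift {p₁} {p} h = begin
      suc n * p                 ≡⟨ solve (n ∷ p ∷ []) ⟩
      n * p + p                 ≡⟨ cong (_+ p) h ⟨
      p₁ + k * p + p            ≡⟨ solve (p₁ ∷ k ∷ p ∷ []) ⟩
      p * suc k + p₁            ∎

  ↓-suc-shifted : ∀ n k →
    n ↓ k * suc k * k + n ↓ suc k * suc k * 2 + n ↓ suc (suc k) ≡ suc n ↓ suc k * n
  ↓-suc-shifted n k = P.trans (lift (↓-step n k) (↓-step n (suc k))) (cong (_* n) (sym (↓-suc n k)))
    where
    lift : ∀ {p₂ p₁ p} → p₁ + k * p ≡ n * p → p₂ + suc k * p₁ ≡ n * p₁ →
           p * suc k * k + p₁ * suc k * 2 + p₂ ≡ (p * suc k + p₁) * n
    lift {p₂} {p₁} {p} h₁ h₂ = begin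
      p * suc k * k + p₁ * suc k * 2 + p₂          ≡⟨ solve (p ∷ p₁ ∷ p₂ ∷ k ∷ []) ⟩
      suc k * (p₁ + k * p) + (p₂ + suc k * p₁)    ≡⟨ cong₂ (λ a b → suc k * a + b) h₁ h₂ ⟩
      suc k * (n * p) + n * p₁                    ≡⟨ solve (p ∷ p₁ ∷ k ∷ n ∷ []) ⟩
      (p * suc k + p₁) * n                        ∎

module PunchInℕ where
  open P using (_≡_; _≢_; cong)

  punchInℕ : ℕ → ℕ → ℕ
  punchInℕ zero    k       = suc k
  punchInℕ (suc j) zero    = zero
  punchInℕ (suc j) (suc k) = suc (punchInℕ j k)

  punchInℕ-< : ∀ {j k} → k ℕ.< j → punchInℕ j k ≡ k
  punchInℕ-< {suc j} {zero}  _           = P.refl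
  punchInℕ-< {suc j} {suc k} (ℕ.s≤s k<j) = cong suc (punchInℕ-< k<j)

  punchInℕ-≥ : ∀ {j k} → j ℕ.≤ k → punchInℕ j k ≡ suc k
  punchInℕ-≥ {zero}          _           = P.refl
  punchInℕ-≥ {suc j} {suc k} (ℕ.s≤s j≤k) = cong suc (punchInℕ-≥ j≤k)

  punchInℕᵢ≢i : ∀ j k → punchInℕ j k ≢ j
  punchInℕᵢ≢i zero    k       ()
  punchInℕᵢ≢i (suc j) zero    ()
  punchInℕᵢ≢i (suc j) (suc k) eq = punchInℕᵢ≢i j k (ℕ.suc-injective eq)

  punchInℕ-comm : ∀ {j k} l → j ℕ.≤ k → punchInℕ j (punchInℕ k l) ≡ punchInℕ (suc k) (punchInℕ j l)
  punchInℕ-comm {zero}          l       _           = P.refl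
  punchInℕ-comm {suc j} {suc k} zero    _           = P.refl
  punchInℕ-comm {suc j} {suc k} (suc l) (ℕ.s≤s j≤k) = cong suc (punchInℕ-comm l j≤k)

  toℕ-punchIn : ∀ {n} (i : Fin (suc n)) (j : Fin n) → toℕ (punchIn i j) ≡ punchInℕ (toℕ i) (toℕ j)
  toℕ-punchIn fzero    j        = P.refl
  toℕ-punchIn (fsuc i) fzero    = P.refl
  toℕ-punchIn (fsuc i) (fsuc j) = cong suc (toℕ-punchIn i j)

  -- the l-th natural number different from both p and q (when p ≢ q)
  punchIn₂ : ℕ → ℕ → ℕ → ℕ
  punchIn₂ p q l = punchInℕ (p ℕ.⊔ q) (punchInℕ (p ℕ.⊓ q) l)

  punchIn₂-comm : ∀ p q l → punchIn₂ p q l ≡ punchIn₂ q p l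
  punchIn₂-comm p q l = P.cong₂ (λ a b → punchInℕ a (punchInℕ b l)) (ℕ.⊔-comm p q) (ℕ.⊓-comm p q)

  punchInℕ-punchInℕ : ∀ j k l → punchInℕ j (punchInℕ k l) ≡ punchIn₂ j (punchInℕ j k) l
  punchInℕ-punchInℕ j k l with k ℕ.<? j
  ... | yes k<j rewrite punchInℕ-< k<j | ℕ.m≥n⇒m⊔n≡m (ℕ.<⇒≤ k<j) | ℕ.m≥n⇒m⊓n≡n (ℕ.<⇒≤ k<j) = P.refl
  ... | no k≮j  rewrite punchInℕ-≥ (ℕ.≮⇒≥ k≮j) | ℕ.m≤n⇒m⊔n≡n (ℕ.m≤n⇒m≤1+n (ℕ.≮⇒≥ k≮j))
                      | ℕ.m≤n⇒m⊓n≡m (ℕ.m≤n⇒m≤1+n (ℕ.≮⇒≥ k≮j)) = punchInℕ-comm l (ℕ.≮⇒≥ k≮j)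

module RangeSum {c ℓ} (R : CommutativeRing c ℓ) where
  open CommutativeRing R hiding (zero)
  open import Algebra.Properties.Ring ring using (-0#≈0#; -‿+-comm; +-cancelˡ)
  open import Algebra.Properties.CommutativeSemigroup +-commutativeSemigroup using (interchange; x∙yz≈y∙xz)
  open import Relation.Binary.Reasoning.Setoid setoid
  open PunchInℕ using (punchInℕ)

  sum< : ℕ → (ℕ → Carrier) → Carrier
  sum< zero    f = 0#
  sum< (suc n) f = f 0 + sum< n (λ j → f (suc j))

  syntax sum< n (λ j → e) = ∑[ j < n ] e

  ∑-cong< : ∀ n {f g : ℕ → Carrier} → (∀ j → j ℕ.< n → f j ≈ g j) → ∑[ j < n ] f j ≈ ∑[ j < n ] g j
  ∑-cong< zero    f≈g = refl
  ∑-cong< (suc n) f≈g = +-cong (f≈g 0 ℕ.z<s) (∑-cong< n (λ j j<n → f≈g (suc j) (ℕ.s<s j<n)))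

  ∑-cong : ∀ n {f g : ℕ → Carrier} → (∀ j → f j ≈ g j) → ∑[ j < n ] f j ≈ ∑[ j < n ] g j
  ∑-cong n f≈g = ∑-cong< n (λ j _ → f≈g j)

  ∑-zero : ∀ n → ∑[ j < n ] 0# ≈ 0#
  ∑-zero zero    = refl
  ∑-zero (suc n) = trans (+-identityˡ _) (∑-zero n)

  ∑-distrib-+ : ∀ n (f g : ℕ → Carrier) → ∑[ j < n ] (f j + g j) ≈ ∑[ j < n ] f j + ∑[ j < n ] g j
  ∑-distrib-+ zero    f g = sym (+-identityˡ 0#)
  ∑-distrib-+ (suc n) f g = trans (+-congˡ (∑-distrib-+ n _ _)) (interchange _ _ _ _)

  *-distribˡ-∑ : ∀ n a (f : ℕ → Carrier) → a * ∑[ j < n ] f j ≈ ∑[ j < n ] (a * f j)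
  *-distribˡ-∑ zero    a f = zeroʳ a
  *-distribˡ-∑ (suc n) a f = trans (distribˡ a _ _) (+-congˡ (*-distribˡ-∑ n a _))

  -‿distrib-∑ : ∀ n (f : ℕ → Carrier) → - ∑[ j < n ] f j ≈ ∑[ j < n ] (- f j)
  -‿distrib-∑ zero    f = -0#≈0#
  -‿distrib-∑ (suc n) f = trans (sym (-‿+-comm _ _)) (+-congˡ (-‿distrib-∑ n _))

  ∑-comm : ∀ m n (G : ℕ → ℕ → Carrier) →
    ∑[ j < m ] ∑[ k < n ] G j k ≈ ∑[ k < n ] ∑[ j < m ] G j k
  ∑-comm zero    n G = sym (∑-zero n)
  ∑-comm (suc m) n G = trans (+-congˡ (∑-comm m n (λ j → G (suc j)))) (sym (∑-distrib-+ n (G 0) _))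

  ∑-init-last : ∀ n (f : ℕ → Carrier) → ∑[ j < suc n ] f j ≈ ∑[ j < n ] f j + f n
  ∑-init-last zero    f = +-comm _ _
  ∑-init-last (suc n) f = trans (+-congˡ (∑-init-last n _)) (sym (+-assoc _ _ _))

  ∑-reverse : ∀ n (f : ℕ → Carrier) → ∑[ j < suc n ] f (n ∸ j) ≈ ∑[ j < suc n ] f j
  ∑-reverse zero    f = refl
  ∑-reverse (suc n) f = begin
    f (suc n) + ∑[ j < suc n ] f (n ∸ j)   ≈⟨ +-congˡ (∑-reverse n f) ⟩
    f (suc n) + ∑[ j < suc n ] f j         ≈⟨ +-comm _ _ ⟩
    ∑[ j < suc n ] f j + f (suc n)         ≈⟨ ∑-init-last (suc n) f ⟨
    ∑[ j < suc (suc n) ] f j               ∎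

  ∑-remove : ∀ {n j} (f : ℕ → Carrier) → j ℕ.≤ n →
    ∑[ k < suc n ] f k ≈ f j + ∑[ k < n ] f (punchInℕ j k)
  ∑-remove {j = zero}          f _              = refl
  ∑-remove {suc n} {suc j}     f (ℕ.s≤s j≤n)    =
    trans (+-congˡ (∑-remove (λ k → f (suc k)) j≤n)) (x∙yz≈y∙xz _ _ _)

  -- Both sides sum G over the pairs (p, q) with p ≢ q: remove the
  -- diagonal from the full double sum before and after exchanging it.
  ∑∑-punchIn-comm : ∀ n (G : ℕ → ℕ → Carrier) →
    ∑[ j < suc n ] ∑[ k < n ] G j (punchInℕ j k) ≈ ∑[ k < suc n ] ∑[ j < n ] G (punchInℕ k j) k
  ∑∑-punchIn-comm n G = +-cancelˡ (∑[ j < suc n ] G j j) _ _ (begin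
    ∑[ j < suc n ] G j j + ∑[ j < suc n ] ∑[ k < n ] G j (punchInℕ j k)
      ≈⟨ ∑-distrib-+ (suc n) (λ j → G j j) (λ j → ∑[ k < n ] G j (punchInℕ j k)) ⟨
    ∑[ j < suc n ] (G j j + ∑[ k < n ] G j (punchInℕ j k))
      ≈⟨ ∑-cong< (suc n) (λ j j<1+n → sym (∑-remove (G j) (ℕ.s≤s⁻¹ j<1+n))) ⟩
    ∑[ j < suc n ] ∑[ k < suc n ] G j k
      ≈⟨ ∑-comm (suc n) (suc n) G ⟩
    ∑[ k < suc n ] ∑[ j < suc n ] G j k
      ≈⟨ ∑-cong< (suc n) (λ k k<1+n → ∑-remove (λ j → G j k) (ℕ.s≤s⁻¹ k<1+n)) ⟩
    ∑[ k < suc n ] (G k k + ∑[ j < n ] G (punchInℕ k j) k)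
      ≈⟨ ∑-distrib-+ (suc n) (λ k → G k k) (λ k → ∑[ j < n ] G (punchInℕ k j) k) ⟩
    ∑[ k < suc n ] G k k + ∑[ k < suc n ] ∑[ j < n ] G (punchInℕ k j) k ∎)

module Determinant {c ℓ} (R : CommutativeRing c ℓ) where
  open CommutativeRing R hiding (zero)
  open import Algebra.Properties.Semiring.Exp semiring using (_^_)
  open import Algebra.Properties.Ring ring using (-0#≈0#; -‿involutive)
  open import Relation.Binary.Reasoning.Setoid setoid
  open RangeSum R
  open PunchInℕ
  open IntegerCoefficientSolver R

  Matrix : Set c
  Matrix = ℕ → ℕ → Carrier

  sign : ℕ → Carrier
  sign j = (- 1#) ^ j

  detℕ : ℕ → Matrix → Carrier
  detℕ zero    A = 1#
  detℕ (suc m) A = ∑[ j < suc m ] (sign j * (A 0 j * detℕ m (λ r k → A (suc r) (punchInℕ j k))))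

  detℕ-cong : ∀ m {A B : Matrix} → (∀ r k → A r k ≈ B r k) → detℕ m A ≈ detℕ m B
  detℕ-cong zero    A≈B = refl
  detℕ-cong (suc m) A≈B = ∑-cong (suc m) λ j →
    *-congˡ {sign j} (*-cong (A≈B 0 j) (detℕ-cong m (λ r k → A≈B (suc r) (punchInℕ j k))))

  infixr 5 _◁_
  _◁_ : (ℕ → Carrier) → Matrix → Matrix
  (u ◁ A) zero    = u
  (u ◁ A) (suc r) = A r

  -- the sign of the term in which rows 0, 1 use columns p, q
  ε : ℕ → ℕ → Carrier
  ε p q with q ℕ.<? p
  ... | yes _ = sign p * sign q
  ... | no  _ = - (sign p * sign q)

  ε-< : ∀ {p q} → q ℕ.< p → ε p q ≈ sign p * sign q
  ε-< {p} {q} q<p with q ℕ.<? p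
  ... | yes _   = refl
  ... | no  q≮p = contradiction q<p q≮p

  ε-≮ : ∀ {p q} → ¬ (q ℕ.< p) → ε p q ≈ - (sign p * sign q)
  ε-≮ {p} {q} q≮p with q ℕ.<? p
  ... | yes q<p = contradiction q<p q≮p
  ... | no  _   = refl

  ε-punchInℕ : ∀ j k → sign j * sign k ≈ ε j (punchInℕ j k)
  ε-punchInℕ j k with k ℕ.<? j
  ... | yes k<j = sym (trans (reflexive (P.cong (ε j) (punchInℕ-< k<j))) (ε-< k<j))
  ... | no  k≮j = begin
    sign j * sign k                     ≈⟨ flip-sign (sign j) (sign k) ⟩
    - (sign j * sign (suc k))           ≈⟨ ε-≮ (λ 1+k<j → k≮j (ℕ.<-trans (ℕ.n<1+n k) 1+k<j)) ⟨
    ε j (suc k)                         ≈⟨ reflexive (P.cong (ε j) (punchInℕ-≥ (ℕ.≮⇒≥ k≮j))) ⟨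
    ε j (punchInℕ j k)                  ∎
    where
    flip-sign : ∀ a b → a * b ≈ - (a * (- 1# * b))
    flip-sign = solve 2 (λ a b → a :* b := :- (a :* (:- con (+ 1) :* b))) refl

  ε-anti : ∀ {p q} → p P.≢ q → ε q p ≈ - ε p q
  ε-anti {p} {q} p≢q with ℕ.<-cmp p q
  ... | tri< p<q _ _ = begin
    ε q p                    ≈⟨ ε-< p<q ⟩
    sign q * sign p          ≈⟨ *-comm _ _ ⟩
    sign p * sign q          ≈⟨ -‿involutive _ ⟨
    - - (sign p * sign q)    ≈⟨ -‿cong (ε-≮ (ℕ.<⇒≯ p<q)) ⟨
    - ε p q                  ∎
  ... | tri≈ _ p≡q _ = contradiction p≡q p≢q
  ... | tri> _ _ q<p = begin
    ε q p                    ≈⟨ ε-≮ (ℕ.<⇒≯ q<p) ⟩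
    - (sign q * sign p)      ≈⟨ -‿cong (*-comm _ _) ⟩
    - (sign p * sign q)      ≈⟨ -‿cong (ε-< q<p) ⟨
    - ε p q                  ∎

  -- Expanding along rows 0 and 1 gives ∑_{p ≢ q} ε p q u_p v_q minor₂ p q, which changes
  -- sign when u and v are exchanged.
  module _ (n : ℕ) (A : Matrix) where
    private
      minor₂ : ℕ → ℕ → Carrier
      minor₂ p q = detℕ n (λ r l → A r (punchIn₂ p q l))

      term : (ℕ → Carrier) → (ℕ → Carrier) → ℕ → ℕ → Carrier
      term u v p q = ε p q * (u p * (v q * minor₂ p q))

      expand : ∀ u v →
        detℕ (suc (suc n)) (u ◁ v ◁ A) ≈ ∑[ j < suc (suc n) ] ∑[ k < suc n ] term u v j (punchInℕ j k)
      expand u v = ∑-cong (suc (suc n)) λ j → begin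
        sign j * (u j * ∑[ k < suc n ] (sign k * (v (punchInℕ j k) * D j k)))
          ≈⟨ *-congˡ (*-distribˡ-∑ (suc n) (u j) (λ k → sign k * (v (punchInℕ j k) * D j k))) ⟩
        sign j * ∑[ k < suc n ] (u j * (sign k * (v (punchInℕ j k) * D j k)))
          ≈⟨ *-distribˡ-∑ (suc n) (sign j) (λ k → u j * (sign k * (v (punchInℕ j k) * D j k))) ⟩
        ∑[ k < suc n ] (sign j * (u j * (sign k * (v (punchInℕ j k) * D j k))))
          ≈⟨ ∑-cong (suc n) (λ k → trans (regroup (sign j) (u j) (sign k) (v (punchInℕ j k)) (D j k))
               (*-cong (ε-punchInℕ j k) (*-congˡ (*-congˡ (D≈minor₂ j k))))) ⟩
        ∑[ k < suc n ] term u v j (punchInℕ j k) ∎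
        where
        D : ℕ → ℕ → Carrier
        D j k = detℕ n (λ r l → A r (punchInℕ j (punchInℕ k l)))
        D≈minor₂ : ∀ j k → D j k ≈ minor₂ j (punchInℕ j k)
        D≈minor₂ j k = detℕ-cong n (λ r l → reflexive (P.cong (A r) (punchInℕ-punchInℕ j k l)))
        regroup : ∀ s u s′ v d → s * (u * (s′ * (v * d))) ≈ (s * s′) * (u * (v * d))
        regroup = solve 5 (λ s u s′ v d → s :* (u :* (s′ :* (v :* d))) := (s :* s′) :* (u :* (v :* d))) refl

      term-anti : ∀ u v {p q} → p P.≢ q → term u v q p ≈ - term v u p q
      term-anti u v {p} {q} p≢q = begin
        ε q p * (u q * (v p * minor₂ q p))   ≈⟨ *-cong (ε-anti p≢q) (*-congˡ (*-congˡ (detℕ-cong n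
                                                  (λ r l → reflexive (P.cong (A r) (punchIn₂-comm q p l)))))) ⟩
        - ε p q * (u q * (v p * minor₂ p q)) ≈⟨ reorder _ _ _ _ ⟩
        - term v u p q                       ∎
        where
        reorder : ∀ e a b d → - e * (a * (b * d)) ≈ - (e * (b * (a * d)))
        reorder = solve 4 (λ e a b d → :- e :* (a :* (b :* d)) := :- (e :* (b :* (a :* d)))) refl

    detℕ-swap₀₁ : ∀ u v → detℕ (suc (suc n)) (u ◁ v ◁ A) ≈ - detℕ (suc (suc n)) (v ◁ u ◁ A)
    detℕ-swap₀₁ u v = begin
      detℕ (suc (suc n)) (u ◁ v ◁ A)
        ≈⟨ expand u v ⟩
      ∑[ j < suc (suc n) ] ∑[ k < suc n ] term u v j (punchInℕ j k)
        ≈⟨ ∑∑-punchIn-comm (suc n) (term u v) ⟩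
      ∑[ k < suc (suc n) ] ∑[ j < suc n ] term u v (punchInℕ k j) k
        ≈⟨ ∑-cong (suc (suc n)) (λ k → ∑-cong (suc n) (λ j →
             term-anti u v (λ eq → punchInℕᵢ≢i k j (P.sym eq)))) ⟩
      ∑[ k < suc (suc n) ] ∑[ j < suc n ] (- term v u k (punchInℕ k j))
        ≈⟨ ∑-cong (suc (suc n)) (λ k → -‿distrib-∑ (suc n) (λ j → term v u k (punchInℕ k j))) ⟨
      ∑[ k < suc (suc n) ] (- ∑[ j < suc n ] term v u k (punchInℕ k j))
        ≈⟨ -‿distrib-∑ (suc (suc n)) (λ k → ∑[ j < suc n ] term v u k (punchInℕ k j)) ⟨
      - ∑[ k < suc (suc n) ] ∑[ j < suc n ] term v u k (punchInℕ k j)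
        ≈⟨ -‿cong (expand v u) ⟨
      - detℕ (suc (suc n)) (v ◁ u ◁ A) ∎

  adjacentSwap : ℕ → ℕ → ℕ
  adjacentSwap zero    zero          = 1
  adjacentSwap zero    (suc zero)    = 0
  adjacentSwap zero    (suc (suc r)) = suc (suc r)
  adjacentSwap (suc k) zero          = zero
  adjacentSwap (suc k) (suc r)       = suc (adjacentSwap k r)

  adjacentSwap-self : ∀ k → adjacentSwap k k P.≡ suc k
  adjacentSwap-self zero    = P.refl
  adjacentSwap-self (suc k) = P.cong suc (adjacentSwap-self k)

  detℕ-adjacentSwap : ∀ k m (A : Matrix) → suc k ℕ.< m →
    detℕ m (λ r → A (adjacentSwap k r)) ≈ - detℕ m A
  detℕ-adjacentSwap zero (suc (suc n)) A _ = begin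
    detℕ (suc (suc n)) (λ r → A (adjacentSwap 0 r))  ≈⟨ detℕ-cong (suc (suc n)) swapped ⟩
    detℕ (suc (suc n)) (A 1 ◁ A 0 ◁ rest)            ≈⟨ detℕ-swap₀₁ n rest (A 1) (A 0) ⟩
    - detℕ (suc (suc n)) (A 0 ◁ A 1 ◁ rest)          ≈⟨ -‿cong (detℕ-cong (suc (suc n)) unchanged) ⟩
    - detℕ (suc (suc n)) A                           ∎
    where
    rest : Matrix
    rest r = A (suc (suc r))
    swapped : ∀ r k → A (adjacentSwap 0 r) k ≈ (A 1 ◁ A 0 ◁ rest) r k
    swapped zero          k = refl
    swapped (suc zero)    k = refl
    swapped (suc (suc r)) k = refl
    unchanged : ∀ r k → (A 0 ◁ A 1 ◁ rest) r k ≈ A r k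
    unchanged zero          k = refl
    unchanged (suc zero)    k = refl
    unchanged (suc (suc r)) k = refl
  detℕ-adjacentSwap zero (suc zero) A (ℕ.s≤s ())
  detℕ-adjacentSwap (suc k) (suc m) A (ℕ.s≤s 1+k<m) = begin
    ∑[ j < suc m ] (sign j * (A 0 j * detℕ m (λ r → minor j (adjacentSwap k r))))
      ≈⟨ ∑-cong (suc m) (λ j → trans (*-congˡ (*-congˡ (detℕ-adjacentSwap k m (minor j) 1+k<m)))
                                      (pull-out (sign j) (A 0 j) (detℕ m (minor j)))) ⟩
    ∑[ j < suc m ] (- (sign j * (A 0 j * detℕ m (minor j))))
      ≈⟨ -‿distrib-∑ (suc m) (λ j → sign j * (A 0 j * detℕ m (minor j))) ⟨
    - detℕ (suc m) A ∎
    where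
    minor : ℕ → Matrix
    minor j r l = A (suc r) (punchInℕ j l)
    pull-out : ∀ s a d → s * (a * - d) ≈ - (s * (a * d))
    pull-out = solve 3 (λ s a d → s :* (a :* :- d) := :- (s :* (a :* d))) refl

  detℕ-equalRows : (∀ {a} → a ≈ - a → a ≈ 0#) →
    ∀ i m (A : Matrix) → suc i ℕ.< m → (∀ k → A (suc i) k ≈ A 0 k) → detℕ m A ≈ 0#
  detℕ-equalRows a≈-a⇒a≈0 zero m A 1<m row₁≈row₀ = a≈-a⇒a≈0 (begin
    detℕ m A                               ≈⟨ detℕ-cong m swap-invariant ⟩
    detℕ m (λ r → A (adjacentSwap 0 r))    ≈⟨ detℕ-adjacentSwap 0 m A 1<m ⟩
    - detℕ m A                             ∎)
    where
    swap-invariant : ∀ r k → A r k ≈ A (adjacentSwap 0 r) k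
    swap-invariant zero          k = sym (row₁≈row₀ k)
    swap-invariant (suc zero)    k = row₁≈row₀ k
    swap-invariant (suc (suc r)) k = refl
  detℕ-equalRows a≈-a⇒a≈0 (suc i) m A 2+i<m row≈row₀ = begin
    detℕ m A          ≈⟨ -‿involutive _ ⟨
    - - detℕ m A      ≈⟨ -‿cong (detℕ-adjacentSwap (suc i) m A 2+i<m) ⟨
    - detℕ m A′       ≈⟨ -‿cong (detℕ-equalRows a≈-a⇒a≈0 i m A′ (ℕ.<-trans (ℕ.n<1+n (suc i)) 2+i<m) row≈row₀′) ⟩
    - 0#              ≈⟨ -0#≈0# ⟩
    0#                ∎
    where
    A′ : Matrix
    A′ r = A (adjacentSwap (suc i) r)
    row≈row₀′ : ∀ k → A′ (suc i) k ≈ A′ 0 k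
    row≈row₀′ k = trans (reflexive (P.cong (λ r → A (suc r) k) (adjacentSwap-self i))) (row≈row₀ k)

module OrderedSqrtFieldProperties {c ℓ} (F : OrderedSqrtField c ℓ) where
  open OrderedSqrtField F hiding (zero)
  open import Algebra.Properties.Ring ring using (-‿distribʳ-*)
  open import Relation.Binary.Reasoning.Setoid setoid
  open IsStrictTotalOrder <-isStrictTotalOrder using (irrefl; <-respʳ-≈; <-respˡ-≈; compare)
    renaming (trans to <-trans)

  0<⇒≉0 : ∀ {a} → 0# < a → ¬ (a ≈ 0#)
  0<⇒≉0 0<a a≈0 = irrefl refl (<-respʳ-≈ a≈0 0<a)

  0<⇒≮0 : ∀ {a} → 0# < a → ¬ (a < 0#)
  0<⇒≮0 0<a a<0 = irrefl refl (<-trans 0<a a<0)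

  +-pos : ∀ {a b} → 0# < a → 0# < b → 0# < a + b
  +-pos {a} {b} 0<a 0<b = <-trans (<-respʳ-≈ (sym (+-identityˡ b)) 0<b) (+-monoˡ-< b 0<a)

  1≉0 : ¬ (1# ≈ 0#)
  1≉0 = 0<⇒≉0 0<1

  *-cancelˡ-≈0 : ∀ {a b} → ¬ (a ≈ 0#) → a * b ≈ 0# → b ≈ 0#
  *-cancelˡ-≈0 {a} {b} a≉0 ab≈0 = begin
    b                  ≈⟨ *-identityˡ b ⟨
    1# * b             ≈⟨ *-congʳ (trans (*-comm _ _) (⁻¹-inverse a≉0)) ⟨
    (a ⁻¹ * a) * b     ≈⟨ *-assoc _ _ _ ⟩
    a ⁻¹ * (a * b)     ≈⟨ *-congˡ ab≈0 ⟩
    a ⁻¹ * 0#          ≈⟨ zeroʳ _ ⟩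
    0#                 ∎

  *-≉0 : ∀ {a b} → ¬ (a ≈ 0#) → ¬ (b ≈ 0#) → ¬ (a * b ≈ 0#)
  *-≉0 a≉0 b≉0 ab≈0 = b≉0 (*-cancelˡ-≈0 a≉0 ab≈0)

  ⁻¹-unique : ∀ {a b} → ¬ (a ≈ 0#) → a * b ≈ 1# → b ≈ a ⁻¹
  ⁻¹-unique {a} {b} a≉0 ab≈1 = begin
    b                    ≈⟨ *-identityʳ b ⟨
    b * 1#               ≈⟨ *-congˡ (⁻¹-inverse a≉0) ⟨
    b * (a * a ⁻¹)       ≈⟨ *-assoc _ _ _ ⟨
    (b * a) * a ⁻¹       ≈⟨ *-congʳ (trans (*-comm b a) ab≈1) ⟩
    1# * a ⁻¹            ≈⟨ *-identityˡ _ ⟩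
    a ⁻¹                 ∎

  ⁻¹-≉0 : ∀ {a} → ¬ (a ≈ 0#) → ¬ (a ⁻¹ ≈ 0#)
  ⁻¹-≉0 {a} a≉0 a⁻¹≈0 = 1≉0 (trans (sym (⁻¹-inverse a≉0)) (trans (*-congˡ a⁻¹≈0) (zeroʳ a)))

  ⁻¹-cong : ∀ {a b} → ¬ (a ≈ 0#) → a ≈ b → a ⁻¹ ≈ b ⁻¹
  ⁻¹-cong a≉0 a≈b = ⁻¹-unique (λ b≈0 → a≉0 (trans a≈b b≈0)) (trans (*-congʳ (sym a≈b)) (⁻¹-inverse a≉0))

  ⁻¹-pos : ∀ {a} → 0# < a → 0# < a ⁻¹
  ⁻¹-pos {a} 0<a with compare 0# (a ⁻¹)
  ... | tri< 0<a⁻¹ _ _ = 0<a⁻¹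
  ... | tri≈ _ 0≈a⁻¹ _ = contradiction (sym 0≈a⁻¹) (⁻¹-≉0 (0<⇒≉0 0<a))
  ... | tri> _ _ a⁻¹<0 = contradiction (<-trans 0<1 1<0) (irrefl refl)
    where
    -- a⁻¹ < 0 gives 0 < - a⁻¹, hence 0 < a * - a⁻¹ = - 1
    0<-a⁻¹ : 0# < - (a ⁻¹)
    0<-a⁻¹ = <-respʳ-≈ (+-identityˡ _) (<-respˡ-≈ (-‿inverseʳ _) (+-monoˡ-< (- (a ⁻¹)) a⁻¹<0))
    0<-1 : 0# < - 1#
    0<-1 = <-respʳ-≈ (trans (sym (-‿distribʳ-* a (a ⁻¹))) (-‿cong (⁻¹-inverse (0<⇒≉0 0<a)))) (*-pos 0<a 0<-a⁻¹)
    1<0 : 1# < 0#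
    1<0 = <-respʳ-≈ (-‿inverseˡ 1#) (<-respˡ-≈ (+-identityˡ 1#) (+-monoˡ-< 1# 0<-1))

  a≈-a⇒a≈0 : ∀ {a} → a ≈ - a → a ≈ 0#
  a≈-a⇒a≈0 {a} a≈-a = *-cancelˡ-≈0 (0<⇒≉0 (+-pos 0<1 0<1)) (begin
    (1# + 1#) * a        ≈⟨ distribʳ _ _ _ ⟩
    1# * a + 1# * a      ≈⟨ +-cong (*-identityˡ a) (*-identityˡ a) ⟩
    a + a                ≈⟨ +-congˡ a≈-a ⟩
    a - a                ≈⟨ -‿inverseʳ a ⟩
    0#                   ∎)

module KoornwinderMoments {c ℓ} (F : OrderedSqrtField c ℓ) (α β γ δ : OrderedSqrtField.Carrier F) where
  open OrderedSqrtField F hiding (zero)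
  open Koornwinder F α β γ δ
  open OrderedSqrtFieldProperties F
  open RangeSum commutativeRing
  open Determinant commutativeRing using (detℕ; detℕ-cong; sign; _◁_; detℕ-equalRows)
  open IntegerCoefficientSolver commutativeRing
  open FallingFactorial
  open PunchInℕ using (punchInℕ; toℕ-punchIn)
  open IsStrictTotalOrder <-isStrictTotalOrder using (<-respʳ-≈)
  open import Algebra.Properties.CommutativeSemigroup *-commutativeSemigroup using (interchange)
  open import Relation.Binary.Reasoning.Setoid setoid

  ι-+ : ∀ m n → ι (m ℕ.+ n) ≈ ι m + ι n
  ι-+ zero    n = sym (+-identityˡ _)
  ι-+ (suc m) n = trans (+-congˡ (ι-+ m n)) (sym (+-assoc _ _ _))

  ι-* : ∀ m n → ι (m ℕ.* n) ≈ ι m * ι n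
  ι-* zero    n = sym (zeroˡ _)
  ι-* (suc m) n = begin
    ι (n ℕ.+ m ℕ.* n)     ≈⟨ ι-+ n (m ℕ.* n) ⟩
    ι n + ι (m ℕ.* n)     ≈⟨ +-cong (sym (*-identityˡ _)) (ι-* m n) ⟩
    1# * ι n + ι m * ι n  ≈⟨ distribʳ _ _ _ ⟨
    (1# + ι m) * ι n      ∎

  +ι-pos : ∀ {a} n → 0# < a → 0# < a + ι n
  +ι-pos zero    0<a = <-respʳ-≈ (sym (+-identityʳ _)) 0<a
  +ι-pos (suc n) 0<a = +-pos 0<a (+ι-pos n 0<1)

  ι-pos : ∀ n → 0# < ι (suc n)
  ι-pos n = +ι-pos n 0<1

  ι-≉0 : ∀ n → ℕ.NonZero n → ¬ (ι n ≈ 0#)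
  ι-≉0 (suc n) _ = 0<⇒≉0 (ι-pos n)

  ^'-+ : ∀ a m n → a ^' (m ℕ.+ n) ≈ a ^' m * a ^' n
  ^'-+ a zero    n = sym (*-identityˡ _)
  ^'-+ a (suc m) n = trans (*-congˡ (^'-+ a m n)) (sym (*-assoc _ _ _))

  ^'-≉0 : ∀ {a} m → ¬ (a ≈ 0#) → ¬ (a ^' m ≈ 0#)
  ^'-≉0 zero    _   = 1≉0
  ^'-≉0 (suc m) a≉0 = *-≉0 a≉0 (^'-≉0 m a≉0)

  ⁻¹-^' : ∀ {a} m → ¬ (a ≈ 0#) → (a ⁻¹) ^' m ≈ (a ^' m) ⁻¹
  ⁻¹-^' {a} m a≉0 = ⁻¹-unique (^'-≉0 m a≉0) (^'-inverse m)
    where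
    ^'-inverse : ∀ m → a ^' m * (a ⁻¹) ^' m ≈ 1#
    ^'-inverse zero    = *-identityʳ 1#
    ^'-inverse (suc m) = begin
      (a * a ^' m) * (a ⁻¹ * (a ⁻¹) ^' m)   ≈⟨ interchange _ _ _ _ ⟩
      (a * a ⁻¹) * (a ^' m * (a ⁻¹) ^' m)   ≈⟨ *-cong (⁻¹-inverse a≉0) (^'-inverse m) ⟩
      1# * 1#                               ≈⟨ *-identityʳ 1# ⟩
      1#                                    ∎

  prodFrom-+ : ∀ a m n (f : ℕ → Carrier) → prodFrom a (m ℕ.+ n) f ≈ prodFrom a m f * prodFrom (a ℕ.+ m) n f
  prodFrom-+ a zero    n f = trans (reflexive (P.cong (λ b → prodFrom b n f) (P.sym (ℕ.+-identityʳ a)))) (sym (*-identityˡ _))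
  prodFrom-+ a (suc m) n f = begin
    f a * prodFrom (suc a) (m ℕ.+ n) f                          ≈⟨ *-congˡ (prodFrom-+ (suc a) m n f) ⟩
    f a * (prodFrom (suc a) m f * prodFrom (suc a ℕ.+ m) n f)   ≈⟨ *-assoc _ _ _ ⟨
    (f a * prodFrom (suc a) m f) * prodFrom (suc a ℕ.+ m) n f   ≈⟨ *-congˡ (reflexive (P.cong (λ b → prodFrom b n f) (P.sym (ℕ.+-suc a m)))) ⟩
    (f a * prodFrom (suc a) m f) * prodFrom (a ℕ.+ suc m) n f   ∎

  prodFrom-pos : ∀ a n {f : ℕ → Carrier} → (∀ i → 0# < f i) → 0# < prodFrom a n f
  prodFrom-pos a zero    f>0 = 0<1
  prodFrom-pos a (suc n) f>0 = *-pos (f>0 a) (prodFrom-pos (suc a) n f>0)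

  prodFrom-snoc : ∀ a n (f : ℕ → Carrier) → prodFrom a (suc n) f ≈ prodFrom a n f * f (a ℕ.+ n)
  prodFrom-snoc a n f = begin
    prodFrom a (suc n) f                      ≡⟨ P.cong (λ m → prodFrom a m f) (ℕ.+-comm 1 n) ⟩
    prodFrom a (n ℕ.+ 1) f                    ≈⟨ prodFrom-+ a n 1 f ⟩
    prodFrom a n f * (f (a ℕ.+ n) * 1#)       ≈⟨ *-congˡ (*-identityʳ _) ⟩
    prodFrom a n f * f (a ℕ.+ n)              ∎

  module NewtonSeries (X : Carrier) where

    rising : ℕ → ℕ → Carrier
    rising m d = prodFrom m d (λ i → X + ι i)

    rising-Δ : ∀ m d → rising (suc m) (suc d) ≈ rising m (suc d) + ι (suc d) * rising (suc m) d
    rising-Δ m d = begin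
      rising (suc m) (suc d)                        ≈⟨ prodFrom-snoc (suc m) d _ ⟩
      rising (suc m) d * (X + (1# + ι (m ℕ.+ d)))   ≈⟨ *-congˡ (+-congˡ (+-congˡ (ι-+ m d))) ⟩
      rising (suc m) d * (X + (1# + (ι m + ι d)))   ≈⟨ split _ _ _ _ ⟩
      (X + ι m) * rising (suc m) d + (1# + ι d) * rising (suc m) d ∎
      where
      split : ∀ p y i j → p * (y + (1# + (i + j))) ≈ (y + i) * p + (1# + j) * p
      split = solve 4 (λ p y i j → p :* (y :+ (con (+ 1) :+ (i :+ j))) := (y :+ i) :* p :+ (con (+ 1) :+ j) :* p) refl

    newton : ℕ → (ℕ → Carrier) → ℕ → ℕ → Carrier
    newton r a t n = ∑[ d < suc r ] (a d * rising (t ℕ.+ n) d)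

    Δcoefficients : (ℕ → Carrier) → ℕ → Carrier
    Δcoefficients a d = a (suc d) * ι (suc d)

    newton-Δ : ∀ r a t n → newton (suc r) a t (suc n) ≈ newton (suc r) a t n + newton r (Δcoefficients a) (suc t) n
    newton-Δ r a t n = begin
      a 0 * 1# + ∑[ d < suc r ] (a (suc d) * rising (t ℕ.+ suc n) (suc d))
        ≈⟨ +-congˡ (∑-cong (suc r) term-Δ) ⟩
      a 0 * 1# + ∑[ d < suc r ] (a (suc d) * rising (t ℕ.+ n) (suc d) + Δcoefficients a d * rising (suc t ℕ.+ n) d)
        ≈⟨ +-congˡ (∑-distrib-+ (suc r) (λ d → a (suc d) * rising (t ℕ.+ n) (suc d)) (λ d → Δcoefficients a d * rising (suc t ℕ.+ n) d)) ⟩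
      a 0 * 1# + (∑[ d < suc r ] (a (suc d) * rising (t ℕ.+ n) (suc d)) + newton r (Δcoefficients a) (suc t) n)
        ≈⟨ +-assoc _ _ _ ⟨
      newton (suc r) a t n + newton r (Δcoefficients a) (suc t) n ∎
      where
      term-Δ : ∀ d → a (suc d) * rising (t ℕ.+ suc n) (suc d)
                   ≈ a (suc d) * rising (t ℕ.+ n) (suc d) + Δcoefficients a d * rising (suc t ℕ.+ n) d
      term-Δ d = begin
        a (suc d) * rising (t ℕ.+ suc n) (suc d)     ≡⟨ P.cong (λ m → a (suc d) * rising m (suc d)) (ℕ.+-suc t n) ⟩
        a (suc d) * rising (suc (t ℕ.+ n)) (suc d)   ≈⟨ *-congˡ (rising-Δ (t ℕ.+ n) d) ⟩
        a (suc d) * (rising (t ℕ.+ n) (suc d) + ι (suc d) * rising (suc t ℕ.+ n) d)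
          ≈⟨ distribute _ _ _ _ ⟩
        a (suc d) * rising (t ℕ.+ n) (suc d) + Δcoefficients a d * rising (suc t ℕ.+ n) d ∎
        where
        distribute : ∀ a p i q → a * (p + i * q) ≈ a * p + (a * i) * q
        distribute = solve 4 (λ a p i q → a :* (p :+ i :* q) := a :* p :+ (a :* i) :* q) refl

    newton-vanishing : ∀ r a t → (∀ k → k ℕ.< r → newton r a t k ≈ 0#) →
      ∀ n → newton r a t n ≈ ι (n C r) * (ι (r !) * a r)
    newton-vanishing zero a t _ n = constant (a 0)
      where
      constant : ∀ a → a * 1# + 0# ≈ (1# + 0#) * ((1# + 0#) * a)
      constant = solve 1 (λ a → a :* con (+ 1) :+ con (+ 0) :=
                                 (con (+ 1) :+ con (+ 0)) :* ((con (+ 1) :+ con (+ 0)) :* a)) refl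
    newton-vanishing (suc r) a t vanishes = go
      where
      Δ-vanishes : ∀ k → k ℕ.< r → newton r (Δcoefficients a) (suc t) k ≈ 0#
      Δ-vanishes k k<r = +-cancelˡ (newton (suc r) a t k) _ _ (begin
        newton (suc r) a t k + newton r (Δcoefficients a) (suc t) k ≈⟨ newton-Δ r a t k ⟨
        newton (suc r) a t (suc k)                                  ≈⟨ vanishes (suc k) (ℕ.s≤s k<r) ⟩
        0#                                                          ≈⟨ vanishes k (ℕ.m<n⇒m<1+n k<r) ⟨
        newton (suc r) a t k                                        ≈⟨ +-identityʳ _ ⟨
        newton (suc r) a t k + 0#                                   ∎)
        where open import Algebra.Properties.Ring ring using (+-cancelˡ)
      leading : Carrier
      leading = ι (suc r !) * a (suc r)
      go : ∀ n → newton (suc r) a t n ≈ ι (n C suc r) * leading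
      go zero    = trans (vanishes 0 ℕ.z<s) (sym (zeroˡ _))
      go (suc n) = begin
        newton (suc r) a t (suc n)
          ≈⟨ newton-Δ r a t n ⟩
        newton (suc r) a t n + newton r (Δcoefficients a) (suc t) n
          ≈⟨ +-cong (go n) (newton-vanishing r (Δcoefficients a) (suc t) Δ-vanishes n) ⟩
        ι (n C suc r) * leading + ι (n C r) * (ι (r !) * (a (suc r) * ι (suc r)))
          ≈⟨ +-congˡ (*-congˡ (trans (regroup _ _ _) (*-congʳ (sym (ι-* (suc r) (r !)))))) ⟩
        ι (n C suc r) * leading + ι (n C r) * leading
          ≈⟨ distribʳ _ _ _ ⟨
        (ι (n C suc r) + ι (n C r)) * leading
          ≈⟨ *-congʳ (trans (+-comm _ _) (sym (ι-+ (n C r) (n C suc r)))) ⟩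
        ι (n C r ℕ.+ n C suc r) * leading
          ≡⟨ P.cong (λ m → ι m * leading) (nCk+nC[k+1]≡[n+1]C[k+1] n r) ⟩
        ι (suc n C suc r) * leading ∎
        where
        regroup : ∀ f a s → f * (a * s) ≈ (s * f) * a
        regroup = solve 3 (λ f a s → f :* (a :* s) := (s :* f) :* a) refl

  tri-diag : ∀ d u l n → tri d u l n n P.≡ d n
  tri-diag d u l zero          = P.refl
  tri-diag d u l (suc zero)    = P.refl
  tri-diag d u l (suc (suc n)) = tri-diag (λ k → d (suc k)) (λ k → u (suc k)) (λ k → l (suc k)) (suc n)

  tri-upper : ∀ d u l n → tri d u l n (suc n) P.≡ u n
  tri-upper d u l zero          = P.refl
  tri-upper d u l (suc zero)    = P.refl
  tri-upper d u l (suc (suc n)) = tri-upper (λ k → d (suc k)) (λ k → u (suc k)) (λ k → l (suc k)) (suc n)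

  tri-lower : ∀ d u l n → tri d u l (suc n) n P.≡ l n
  tri-lower d u l zero          = P.refl
  tri-lower d u l (suc zero)    = P.refl
  tri-lower d u l (suc (suc n)) = tri-lower (λ k → d (suc k)) (λ k → u (suc k)) (λ k → l (suc k)) (suc n)

  tri-far : ∀ d u l j e → tri d u l j (suc (suc (j ℕ.+ e))) P.≡ 0#
  tri-far d u l zero          e = P.refl
  tri-far d u l (suc zero)    e = P.refl
  tri-far d u l (suc (suc j)) e = tri-far (λ k → d (suc k)) (λ k → u (suc k)) (λ k → l (suc k)) (suc j) e

  sumUpTo-zero : ∀ n (f : ℕ → Carrier) → (∀ j → j ℕ.≤ n → f j ≈ 0#) → sumUpTo n f ≈ 0#
  sumUpTo-zero zero    f f≈0 = f≈0 0 ℕ.z≤n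
  sumUpTo-zero (suc n) f f≈0 =
    trans (+-cong (sumUpTo-zero n f (λ j j≤n → f≈0 j (ℕ.m≤n⇒m≤1+n j≤n))) (f≈0 (suc n) ℕ.≤-refl)) (+-identityˡ 0#)

  ⊙-column : ∀ (A B : Mat) → (∀ j e → B j (suc (suc (j ℕ.+ e))) ≈ 0#) → ∀ i k →
    (A ⊙ B) i (suc k) ≈ A i k * B k (suc k) + A i (suc k) * B (suc k) (suc k) + A i (suc (suc k)) * B (suc (suc k)) (suc k)
  ⊙-column A B far i k = +-congʳ (+-congʳ (upper-only k))
    where
    upper-only : ∀ k → sumUpTo k (λ j → A i j * B j (suc k)) ≈ A i k * B k (suc k)
    upper-only zero    = refl
    upper-only (suc k) = trans (+-congʳ (sumUpTo-zero k _ vanishing)) (+-identityˡ _)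
      where
      vanishing : ∀ j → j ℕ.≤ k → A i j * B j (suc (suc k)) ≈ 0#
      vanishing j j≤k = trans (*-congˡ (trans (reflexive (P.cong (λ m → B j (suc (suc m))) (P.sym (ℕ.m+[n∸m]≡n j≤k))))
                                                  (far j (k ∸ j))))
                              (zeroʳ _)

  sumFin≈∑ : ∀ n (f : Fin n → Carrier) (g : ℕ → Carrier) → (∀ i → f i ≈ g (toℕ i)) → sumFin n f ≈ ∑[ j < n ] g j
  sumFin≈∑ zero    f g f≈g = refl
  sumFin≈∑ (suc n) f g f≈g = +-cong (f≈g fzero) (sumFin≈∑ n (λ i → f (fsuc i)) (λ j → g (suc j)) (λ i → f≈g (fsuc i)))

  ^'≈sign : ∀ j → (- 1#) ^' j ≈ sign j
  ^'≈sign zero    = refl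
  ^'≈sign (suc j) = *-congˡ (^'≈sign j)

  det≈detℕ : ∀ m (A : Fin m → Fin m → Carrier) (B : ℕ → ℕ → Carrier) →
    (∀ i j → A i j ≈ B (toℕ i) (toℕ j)) → det m A ≈ detℕ m B
  det≈detℕ zero    A B A≈B = refl
  det≈detℕ (suc m) A B A≈B = sumFin≈∑ (suc m) _ (λ j → sign j * (B 0 j * detℕ m (λ r k → B (suc r) (punchInℕ j k)))) λ j →
    *-cong (^'≈sign (toℕ j)) (*-cong (A≈B fzero j) (det≈detℕ m _ (λ r k → B (suc r) (punchInℕ (toℕ j) k)) λ r k →
      trans (A≈B (fsuc r) (punchIn j k)) (reflexive (P.cong (B (suc (toℕ r))) (toℕ-punchIn j k)))))

  module Positive (0<α : 0# < α) (0<β : 0# < β) (0<γ : 0# < γ) (0<δ : 0# < δ) where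

    0<α+γ : 0# < α + γ
    0<α+γ = +-pos 0<α 0<γ

    0<β+δ : 0# < β + δ
    0<β+δ = +-pos 0<β 0<δ

    0<den : 0# < den
    0<den = *-pos 0<α+γ 0<β+δ

    0<x : 0# < x
    0<x = *-pos (+-pos (+-pos (+-pos 0<α 0<β) 0<γ) 0<δ) (⁻¹-pos 0<den)

    J : Mat
    J = 𝒟 ⊕ ℰ

    J-diag : ∀ n → J n n ≈ x + ι 2 * ι n
    J-diag n = begin
      𝒟 n n + ℰ n n
        ≡⟨ P.cong₂ _+_ (tri-diag _ _ _ n) (tri-diag _ _ _ n) ⟩
      (α + δ + ι n * (α * β + ι 2 * α * δ + γ * δ)) * den ⁻¹ + (β + γ + ι n * (α * β + ι 2 * β * γ + γ * δ)) * den ⁻¹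
        ≈⟨ collect α β γ δ (ι n) (den ⁻¹) ⟩
      x + ι 2 * ι n * (den * den ⁻¹)
        ≈⟨ +-congˡ (trans (*-congˡ (⁻¹-inverse (0<⇒≉0 0<den))) (*-identityʳ _)) ⟩
      x + ι 2 * ι n ∎
      where
      collect : ∀ a b g d i v →
        (a + d + i * (a * b + (1# + (1# + 0#)) * a * d + g * d)) * v + (b + g + i * (a * b + (1# + (1# + 0#)) * b * g + g * d)) * v
          ≈ (a + b + g + d) * v + (1# + (1# + 0#)) * i * ((a + g) * (b + d) * v)
      collect = solve 6 (λ a b g d i v →
        (a :+ d :+ i :* (a :* b :+ two :* a :* d :+ g :* d)) :* v :+ (b :+ g :+ i :* (a :* b :+ two :* b :* g :+ g :* d)) :* v
          := (a :+ b :+ g :+ d) :* v :+ two :* i :* ((a :+ g) :* (b :+ d) :* v)) refl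
        where two = con (+ 1) :+ (con (+ 1) :+ con (+ 0))

    merge : ∀ {a b s} → ¬ (s ≈ 0#) → a + b ≈ s → ∀ o → a * s ⁻¹ * o + b * s ⁻¹ * o ≈ o
    merge {a} {b} {s} s≉0 a+b≈s o = begin
      a * s ⁻¹ * o + b * s ⁻¹ * o   ≈⟨ factor _ _ _ _ ⟩
      (a + b) * s ⁻¹ * o            ≈⟨ *-congʳ (*-congʳ a+b≈s) ⟩
      s * s ⁻¹ * o                  ≈⟨ *-congʳ (⁻¹-inverse s≉0) ⟩
      1# * o                        ≈⟨ *-identityˡ o ⟩
      o                             ∎
      where
      factor : ∀ a b v o → a * v * o + b * v * o ≈ (a + b) * v * o
      factor = solve 4 (λ a b v o → a :* v :* o :+ b :* v :* o := (a :+ b) :* v :* o) refl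

    J-upper : ∀ n → J n (suc n) ≈ off n
    J-upper n = trans (reflexive (P.cong₂ _+_ (tri-upper _ _ _ n) (tri-upper _ _ _ n)))
                      (merge (0<⇒≉0 0<α+γ) refl (off n))

    J-lower : ∀ n → J (suc n) n ≈ off n
    J-lower n = trans (reflexive (P.cong₂ _+_ (tri-lower _ _ _ n) (tri-lower _ _ _ n)))
                      (merge (0<⇒≉0 0<β+δ) (+-comm δ β) (off n))

    J-far : ∀ j e → J j (suc (suc (j ℕ.+ e))) ≈ 0#
    J-far j e = trans (reflexive (P.cong₂ _+_ (tri-far _ _ _ j e) (tri-far _ _ _ j e))) (+-identityˡ 0#)

    off² : ∀ k → off k * off k ≈ ι (suc k) * (x + ι k)
    off² k = √-square (0<⇒≮0 (*-pos (ι-pos k) (+ι-pos k 0<x)))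

    open NewtonSeries x using (rising)

    ι-↓-suc : ∀ N k → ι (N ↓ k) * ι (suc k) + ι (N ↓ suc k) ≈ ι (suc N ↓ suc k)
    ι-↓-suc N k = begin
      ι (N ↓ k) * ι (suc k) + ι (N ↓ suc k)      ≈⟨ +-congʳ (ι-* (N ↓ k) (suc k)) ⟨
      ι (N ↓ k ℕ.* suc k) + ι (N ↓ suc k)        ≈⟨ ι-+ (N ↓ k ℕ.* suc k) (N ↓ suc k) ⟨
      ι (N ↓ k ℕ.* suc k ℕ.+ N ↓ suc k)          ≡⟨ P.cong ι (↓-suc N k) ⟨
      ι (suc N ↓ suc k)                          ∎

    ι-↓-suc-shifted : ∀ N k →
      ι (N ↓ k) * ι (suc k) * ι k + ι (N ↓ suc k) * ι (suc k) * ι 2 + ι (N ↓ suc (suc k)) ≈ ι (suc N ↓ suc k) * ι N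
    ι-↓-suc-shifted N k = begin
      ι p * ι (suc k) * ι k + ι p₁ * ι (suc k) * ι 2 + ι p₂
        ≈⟨ +-congʳ (+-cong (ι-*₃ p (suc k) k) (ι-*₃ p₁ (suc k) 2)) ⟨
      ι (p ℕ.* suc k ℕ.* k) + ι (p₁ ℕ.* suc k ℕ.* 2) + ι p₂
        ≈⟨ trans (ι-+ (p ℕ.* suc k ℕ.* k ℕ.+ p₁ ℕ.* suc k ℕ.* 2) p₂) (+-congʳ (ι-+ (p ℕ.* suc k ℕ.* k) (p₁ ℕ.* suc k ℕ.* 2))) ⟨
      ι (p ℕ.* suc k ℕ.* k ℕ.+ p₁ ℕ.* suc k ℕ.* 2 ℕ.+ p₂)
        ≡⟨ P.cong ι (↓-suc-shifted N k) ⟩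
      ι (suc N ↓ suc k ℕ.* N)
        ≈⟨ ι-* (suc N ↓ suc k) N ⟩
      ι (suc N ↓ suc k) * ι N ∎
      where
      p = N ↓ k
      p₁ = N ↓ suc k
      p₂ = N ↓ suc (suc k)
      ι-*₃ : ∀ a b c → ι (a ℕ.* b ℕ.* c) ≈ ι a * ι b * ι c
      ι-*₃ a b c = trans (ι-* (a ℕ.* b) c) (*-congʳ (ι-* a b))

    ↓-recurrence : ∀ N k P →
      ι (N ↓ k) * P * (ι (suc k) * (x + ι k)) + ι (N ↓ suc k) * P * (x + ι 2 * ι (suc k)) + ι (N ↓ suc (suc k)) * P
        ≈ ι (suc N ↓ suc k) * (P * (x + ι N))
    ↓-recurrence N k P = begin
      h₀ * P * (ι (suc k) * (x + ι k)) + h₁ * P * (x + ι 2 * ι (suc k)) + h₂ * P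
        ≈⟨ collect h₀ h₁ h₂ P x (ι (suc k)) (ι k) (ι 2) ⟩
      (h₀ * ι (suc k) + h₁) * (x * P) + (h₀ * ι (suc k) * ι k + h₁ * ι (suc k) * ι 2 + h₂) * P
        ≈⟨ +-cong (*-congʳ (ι-↓-suc N k)) (*-congʳ (ι-↓-suc-shifted N k)) ⟩
      ι (suc N ↓ suc k) * (x * P) + ι (suc N ↓ suc k) * ι N * P
        ≈⟨ factor _ _ _ _ ⟩
      ι (suc N ↓ suc k) * (P * (x + ι N)) ∎
      where
      h₀ = ι (N ↓ k)
      h₁ = ι (N ↓ suc k)
      h₂ = ι (N ↓ suc (suc k))
      collect : ∀ h₀ h₁ h₂ P y s i t →
        h₀ * P * (s * (y + i)) + h₁ * P * (y + t * s) + h₂ * P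
          ≈ (h₀ * s + h₁) * (y * P) + (h₀ * s * i + h₁ * s * t + h₂) * P
      collect = solve 8 (λ h₀ h₁ h₂ P y s i t →
        h₀ :* P :* (s :* (y :+ i)) :+ h₁ :* P :* (y :+ t :* s) :+ h₂ :* P
          := (h₀ :* s :+ h₁) :* (y :* P) :+ (h₀ :* s :* i :+ h₁ :* s :* t :+ h₂) :* P) refl
      factor : ∀ h y P n → h * (y * P) + h * n * P ≈ h * (P * (y + n))
      factor = solve 4 (λ h y P n → h :* (y :* P) :+ h :* n :* P := h :* (P :* (y :+ n))) refl

    firstRow : ℕ → ℕ → Carrier
    firstRow N k = pow J N 0 k

    offProd : ℕ → Carrier
    offProd zero    = 1#
    offProd (suc k) = offProd k * off k

    WeightedFirstRow : ℕ → Set ℓ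
    WeightedFirstRow N = ∀ k → firstRow N k * offProd k ≈ ι (N ↓ k) * rising 0 N

    firstRow-step₀ : ∀ N → WeightedFirstRow N → firstRow (suc N) 0 * 1# ≈ ι 1 * rising 0 (suc N)
    firstRow-step₀ N hyp = begin
      (w₀ * J 0 0 + w₁ * J 1 0) * 1#
        ≈⟨ *-congʳ (+-cong (*-congˡ (J-diag 0)) (*-congˡ (J-lower 0))) ⟩
      (w₀ * (x + ι 2 * 0#) + w₁ * off 0) * 1#
        ≈⟨ regroup w₀ w₁ x (ι 2) (off 0) ⟩
      w₀ * 1# * x + w₁ * (1# * off 0)
        ≈⟨ +-cong (*-congʳ (hyp 0)) (hyp 1) ⟩
      ι 1 * P * x + ι (N ↓ 1) * P
        ≡⟨ P.cong (λ n → ι 1 * P * x + ι n * P) (n↓1≡n N) ⟩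
      ι 1 * P * x + ι N * P
        ≈⟨ factor P x (ι N) ⟩
      ι 1 * (P * (x + ι N))
        ≈⟨ *-congˡ (prodFrom-snoc 0 N _) ⟨
      ι 1 * rising 0 (suc N) ∎
      where
      w₀ = firstRow N 0
      w₁ = firstRow N 1
      P = rising 0 N
      regroup : ∀ w₀ w₁ y t o → (w₀ * (y + t * 0#) + w₁ * o) * 1# ≈ w₀ * 1# * y + w₁ * (1# * o)
      regroup = solve 5 (λ w₀ w₁ y t o → (w₀ :* (y :+ t :* con (+ 0)) :+ w₁ :* o) :* con (+ 1)
                                          := w₀ :* con (+ 1) :* y :+ w₁ :* (con (+ 1) :* o)) refl
      factor : ∀ P y n → (1# + 0#) * P * y + n * P ≈ (1# + 0#) * (P * (y + n))
      factor = solve 3 (λ P y n → (con (+ 1) :+ con (+ 0)) :* P :* y :+ n :* P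
                                   := (con (+ 1) :+ con (+ 0)) :* (P :* (y :+ n))) refl

    firstRow-step : ∀ N k → WeightedFirstRow N →
      firstRow (suc N) (suc k) * offProd (suc k) ≈ ι (suc N ↓ suc k) * rising 0 (suc N)
    firstRow-step N k hyp = begin
      firstRow (suc N) (suc k) * (q * off k)
        ≈⟨ *-congʳ (⊙-column (pow J N) J J-far 0 k) ⟩
      (w₀ * J k (suc k) + w₁ * J (suc k) (suc k) + w₂ * J (suc (suc k)) (suc k)) * (q * off k)
        ≈⟨ *-congʳ (+-cong (+-cong (*-congˡ (J-upper k)) (*-congˡ (J-diag (suc k)))) (*-congˡ (J-lower (suc k)))) ⟩
      (w₀ * off k + w₁ * (x + ι 2 * ι (suc k)) + w₂ * off (suc k)) * (q * off k)
        ≈⟨ regroup w₀ w₁ w₂ q (off k) (off (suc k)) (x + ι 2 * ι (suc k)) ⟩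
      w₀ * q * (off k * off k) + w₁ * (q * off k) * (x + ι 2 * ι (suc k)) + w₂ * (q * off k * off (suc k))
        ≈⟨ +-cong (+-cong (*-cong (hyp k) (off² k)) (*-congʳ (hyp (suc k)))) (hyp (suc (suc k))) ⟩
      ι (N ↓ k) * P * (ι (suc k) * (x + ι k)) + ι (N ↓ suc k) * P * (x + ι 2 * ι (suc k)) + ι (N ↓ suc (suc k)) * P
        ≈⟨ ↓-recurrence N k P ⟩
      ι (suc N ↓ suc k) * (P * (x + ι N))
        ≈⟨ *-congˡ (prodFrom-snoc 0 N _) ⟨
      ι (suc N ↓ suc k) * rising 0 (suc N) ∎
      where
      w₀ = firstRow N k
      w₁ = firstRow N (suc k)
      w₂ = firstRow N (suc (suc k))
      q = offProd k
      P = rising 0 N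
      regroup : ∀ w₀ w₁ w₂ q o o′ b →
        (w₀ * o + w₁ * b + w₂ * o′) * (q * o) ≈ w₀ * q * (o * o) + w₁ * (q * o) * b + w₂ * (q * o * o′)
      regroup = solve 7 (λ w₀ w₁ w₂ q o o′ b → (w₀ :* o :+ w₁ :* b :+ w₂ :* o′) :* (q :* o)
                                             := w₀ :* q :* (o :* o) :+ w₁ :* (q :* o) :* b :+ w₂ :* (q :* o :* o′)) refl

    -- Rescaling column k by off 0 ⋯ off (k - 1) turns J into a tridiagonal matrix with
    -- subdiagonal 1 and superdiagonal (k + 1)(x + k); its first row is explicit.
    firstRow-closedForm : ∀ N → WeightedFirstRow N
    firstRow-closedForm zero    zero          = sym (*-congʳ (+-identityʳ 1#))
    firstRow-closedForm zero    (suc zero)    = trans (zeroˡ _) (sym (zeroˡ _))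
    firstRow-closedForm zero    (suc (suc k)) = trans (zeroˡ _) (sym (zeroˡ _))
    firstRow-closedForm (suc N) zero          = firstRow-step₀ N (firstRow-closedForm N)
    firstRow-closedForm (suc N) (suc k)       = firstRow-step N k (firstRow-closedForm N)

    Z-closedForm : ∀ N → Z N ≈ S ^' N * rising 0 N
    Z-closedForm N = *-congˡ (begin
      firstRow N 0                 ≈⟨ *-identityʳ _ ⟨
      firstRow N 0 * 1#            ≈⟨ firstRow-closedForm N 0 ⟩
      (1# + 0#) * rising 0 N       ≈⟨ trans (*-congʳ (+-identityʳ 1#)) (*-identityˡ _) ⟩
      rising 0 N                   ∎)

    module NonDegenerate (αβ≉γδ : ¬ (α * β ≈ γ * δ)) where

      αβ-γδ≉0 : ¬ (α * β - γ * δ ≈ 0#)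
      αβ-γδ≉0 αβ-γδ≈0 = αβ≉γδ (begin
        α * β                         ≈⟨ +-identityʳ _ ⟨
        α * β + 0#                    ≈⟨ +-congˡ (-‿inverseˡ (γ * δ)) ⟨
        α * β + (- (γ * δ) + γ * δ)   ≈⟨ +-assoc _ _ _ ⟨
        α * β - γ * δ + γ * δ         ≈⟨ +-congʳ αβ-γδ≈0 ⟩
        0# + γ * δ                    ≈⟨ +-identityˡ _ ⟩
        γ * δ                         ∎)

      S≉0 : ¬ (S ≈ 0#)
      S≉0 = *-≉0 (0<⇒≉0 0<den) (⁻¹-≉0 αβ-γδ≉0)

      moment : ℕ → Carrier
      moment n = S ^' n * rising 0 n

      moment-≉0 : ∀ n → ¬ (moment n ≈ 0#)
      moment-≉0 n = *-≉0 (^'-≉0 n S≉0) (0<⇒≉0 (prodFrom-pos 0 n (λ i → +ι-pos i 0<x)))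

      moment-+ : ∀ m n → moment (m ℕ.+ n) ≈ moment m * (S ^' n * rising m n)
      moment-+ m n = trans (*-cong (^'-+ S m n) (prodFrom-+ 0 m n _)) (interchange _ _ _ _)

      hankel : ℕ → Carrier
      hankel r = detℕ (suc r) (λ i j → moment ((r ∸ i) ℕ.+ (r ∸ j)))

      module HookRow (r : ℕ) where

        lowerRows : Mat
        lowerRows i j = moment ((r ∸ suc i) ℕ.+ (r ∸ j))

        f : ℕ → Carrier
        f n = detℕ (suc r) ((λ j → moment (n ℕ.+ (r ∸ j))) ◁ lowerRows)

        cofactor : ℕ → Carrier
        cofactor j = detℕ r (λ i k → lowerRows i (punchInℕ j k))

        cofactorTerm : ℕ → Carrier
        cofactorTerm j = sign j * (S ^' (r ∸ j) * cofactor j)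

        coefficient : ℕ → Carrier
        coefficient d = cofactorTerm (r ∸ d)

        open NewtonSeries x using (newton; newton-vanishing)

        g : ℕ → Carrier
        g n = newton r coefficient 0 n

        f≈moment*g : ∀ n → f n ≈ moment n * g n
        f≈moment*g n = begin
          ∑[ j < suc r ] (sign j * (moment (n ℕ.+ (r ∸ j)) * cofactor j))
            ≈⟨ ∑-cong (suc r) (λ j → trans (*-congˡ {sign j} (*-congʳ (moment-+ n (r ∸ j))))
                                              (regroup (sign j) (moment n) (S ^' (r ∸ j)) (rising n (r ∸ j)) (cofactor j))) ⟩
          ∑[ j < suc r ] (moment n * term j)
            ≈⟨ *-distribˡ-∑ (suc r) (moment n) term ⟨
          moment n * ∑[ j < suc r ] term j
            ≈⟨ *-congˡ (∑-reverse r term) ⟨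
          moment n * ∑[ d < suc r ] term (r ∸ d)
            ≈⟨ *-congˡ (∑-cong< (suc r) (λ d d<1+r → *-congˡ {coefficient d} (reflexive (P.cong (rising n) (ℕ.m∸[m∸n]≡n (ℕ.s≤s⁻¹ d<1+r)))))) ⟩
          moment n * g n ∎
          where
          term : ℕ → Carrier
          term j = cofactorTerm j * rising n (r ∸ j)
          regroup : ∀ s m p q c → s * ((m * (p * q)) * c) ≈ m * ((s * (p * c)) * q)
          regroup = solve 5 (λ s m p q c → s :* ((m :* (p :* q)) :* c) := m :* ((s :* (p :* c)) :* q)) refl

        f-vanishes : ∀ k → k ℕ.< r → f k ≈ 0#
        f-vanishes k k<r =
          detℕ-equalRows a≈-a⇒a≈0 (r ∸ suc k) (suc r) ((λ j → moment (k ℕ.+ (r ∸ j))) ◁ lowerRows) (ℕ.s≤s (∸-< k<r)) repeated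
          where
          ∸-< : ∀ {r k} → k ℕ.< r → r ∸ suc k ℕ.< r
          ∸-< {suc r} {k} _ = ℕ.s≤s (ℕ.m∸n≤m r k)
          ∸-∸ : ∀ {r k} → k ℕ.< r → r ∸ suc (r ∸ suc k) P.≡ k
          ∸-∸ {suc r} (ℕ.s≤s k≤r) = ℕ.m∸[m∸n]≡n k≤r
          repeated : ∀ j → lowerRows (r ∸ suc k) j ≈ moment (k ℕ.+ (r ∸ j))
          repeated j = reflexive (P.cong (λ i → moment (i ℕ.+ (r ∸ j))) (∸-∸ k<r))

        g-closedForm : ∀ n → g n ≈ ι (n C r) * (ι (r !) * coefficient r)
        g-closedForm = newton-vanishing r coefficient 0 λ k k<r →
          *-cancelˡ-≈0 (moment-≉0 k) (trans (sym (f≈moment*g k)) (f-vanishes k k<r))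

        leading≈ : coefficient r ≈ S ^' r * cofactor 0
        leading≈ = trans (reflexive (P.cong cofactorTerm (ℕ.n∸n≡0 r))) (*-identityˡ _)

        f-self : f r ≈ moment r * (ι (r !) * coefficient r)
        f-self = begin
          f r                                                  ≈⟨ f≈moment*g r ⟩
          moment r * g r                                       ≈⟨ *-congˡ (g-closedForm r) ⟩
          moment r * (ι (r C r) * (ι (r !) * coefficient r))   ≡⟨ P.cong (λ m → moment r * (ι m * (ι (r !) * coefficient r))) (nCn≡1 r) ⟩
          moment r * ((1# + 0#) * (ι (r !) * coefficient r))   ≈⟨ *-congˡ (trans (*-congʳ (+-identityʳ 1#)) (*-identityˡ _)) ⟩
          moment r * (ι (r !) * coefficient r)                 ∎

        f-self-≉0 : ¬ (cofactor 0 ≈ 0#) → ¬ (f r ≈ 0#)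
        f-self-≉0 cofactor₀≉0 fr≈0 = *-≉0 (moment-≉0 r) (*-≉0 (ι-≉0 (r !) (r ℕ.!≢0))
          (λ c≈0 → *-≉0 (^'-≉0 r S≉0) cofactor₀≉0 (trans (sym leading≈) c≈0))) (trans (sym f-self) fr≈0)

        f≈hankel : f r ≈ hankel r
        f≈hankel = detℕ-cong (suc r) rows
          where
          rows : ∀ i j → ((λ j → moment (r ℕ.+ (r ∸ j))) ◁ lowerRows) i j ≈ moment ((r ∸ i) ℕ.+ (r ∸ j))
          rows zero    j = refl
          rows (suc i) j = refl

        f-ratio : ∀ {N} → r ℕ.≤ N → f N ≈ f r * (S ^' (N ∸ r) * (ι (N C r) * rising r (N ∸ r)))
        f-ratio {N} r≤N = begin
          f N                                                    ≈⟨ f≈moment*g N ⟩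
          moment N * g N                                         ≡⟨ P.cong (λ n → moment n * g N) (ℕ.m+[n∸m]≡n r≤N) ⟨
          moment (r ℕ.+ (N ∸ r)) * g N                           ≈⟨ *-cong (moment-+ r (N ∸ r)) (g-closedForm N) ⟩
          moment r * (S ^' (N ∸ r) * rising r (N ∸ r)) * (ι (N C r) * (ι (r !) * coefficient r))
            ≈⟨ regroup _ _ _ _ _ ⟩
          moment r * (ι (r !) * coefficient r) * (S ^' (N ∸ r) * (ι (N C r) * rising r (N ∸ r)))
            ≈⟨ *-congʳ f-self ⟨
          f r * (S ^' (N ∸ r) * (ι (N C r) * rising r (N ∸ r))) ∎
          where
          regroup : ∀ m s p b l → m * (s * p) * (b * l) ≈ m * l * (s * (b * p))
          regroup = solve 5 (λ m s p b l → m :* (s :* p) :* (b :* l) := m :* l :* (s :* (b :* p))) refl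

      hankel-≉0 : ∀ r → ¬ (hankel r ≈ 0#)
      hankel-≉0 r hankel≈0 = HookRow.f-self-≉0 r (cofactor₀-≉0 r) (trans (HookRow.f≈hankel r) hankel≈0)
        where
        cofactor₀-≉0 : ∀ r → ¬ (HookRow.cofactor r 0 ≈ 0#)
        cofactor₀-≉0 zero    = 1≉0
        cofactor₀-≉0 (suc r) = hankel-≉0 r

      hook-numerator : ∀ {N r} → r ℕ.≤ N →
        det (suc r) (λ i j → Z (hook N r i ℕ.+ (suc r ∸ suc (toℕ i)) ℕ.+ (suc r ∸ suc (toℕ j)))) ≈ HookRow.f r N
      hook-numerator {N} {r} r≤N = det≈detℕ (suc r) _ ((λ j → moment (N ℕ.+ (r ∸ j))) ◁ HookRow.lowerRows r) entries
        where
        entries : ∀ i j → Z (hook N r i ℕ.+ (suc r ∸ suc (toℕ i)) ℕ.+ (suc r ∸ suc (toℕ j)))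
                        ≈ ((λ j → moment (N ℕ.+ (r ∸ j))) ◁ HookRow.lowerRows r) (toℕ i) (toℕ j)
        entries fzero    j = trans (Z-closedForm (N ∸ r ℕ.+ r ℕ.+ (r ∸ toℕ j))) (reflexive (P.cong (λ n → moment (n ℕ.+ (r ∸ toℕ j))) (ℕ.m∸n+n≡m r≤N)))
        entries (fsuc i) j = Z-closedForm ((r ∸ suc (toℕ i)) ℕ.+ (r ∸ toℕ j))

      hook-denominator : ∀ r →
        det (suc r) (λ i j → Z ((suc r ∸ suc (toℕ i)) ℕ.+ (suc r ∸ suc (toℕ j)))) ≈ hankel r
      hook-denominator r = det≈detℕ (suc r) _ (λ i j → moment ((r ∸ i) ℕ.+ (r ∸ j))) (λ i j → Z-closedForm ((r ∸ toℕ i) ℕ.+ (r ∸ toℕ j)))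

      K-hook : ∀ {N r} → r ℕ.≤ N →
        K (suc r) (hook N r) ≈ S ^' (N ∸ r) * (ι (N C r) * prodRange r N (λ i → x + ι i))
      K-hook {N} {r} r≤N = begin
        K (suc r) (hook N r)          ≈⟨ *-cong (hook-numerator r≤N) (⁻¹-cong denominator≉0 (trans (hook-denominator r) (sym (f≈hankel)))) ⟩
        f N * f r ⁻¹                  ≈⟨ *-congʳ (f-ratio r≤N) ⟩
        f r * Y * f r ⁻¹              ≈⟨ cancel (f r) Y (f r ⁻¹) ⟩
        (f r * f r ⁻¹) * Y            ≈⟨ *-congʳ (⁻¹-inverse (λ fr≈0 → hankel-≉0 r (trans (sym f≈hankel) fr≈0))) ⟩
        1# * Y                        ≈⟨ *-identityˡ Y ⟩
        Y                             ∎
        where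
        open HookRow r
        Y : Carrier
        Y = S ^' (N ∸ r) * (ι (N C r) * rising r (N ∸ r))
        denominator≉0 : ¬ (det (suc r) (λ i j → Z ((suc r ∸ suc (toℕ i)) ℕ.+ (suc r ∸ suc (toℕ j)))) ≈ 0#)
        denominator≉0 d≈0 = hankel-≉0 r (trans (sym (hook-denominator r)) d≈0)
        cancel : ∀ a y b → a * y * b ≈ (a * b) * y
        cancel = solve 3 (λ a y b → a :* y :* b := (a :* b) :* y) refl

      S-rising : ∀ m a → S ^' m * prodFrom a m (λ i → x + ι i)
        ≈ ((α * β - γ * δ) ^' m) ⁻¹ * prodFrom a m (λ i → α + β + γ + δ + ι i * ((α + γ) * (β + δ)))
      S-rising m a = trans (S-rising′ m a) (*-congʳ (⁻¹-^' m αβ-γδ≉0))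
        where
        step : ∀ i → S * (x + ι i) ≈ (α * β - γ * δ) ⁻¹ * (α + β + γ + δ + ι i * ((α + γ) * (β + δ)))
        step i = trans (expand den ((α * β - γ * δ) ⁻¹) (α + β + γ + δ) (den ⁻¹) (ι i))
                       (*-congˡ (+-congʳ (trans (*-congˡ (⁻¹-inverse (0<⇒≉0 0<den))) (*-identityʳ _))))
          where
          expand : ∀ d e s v i → d * e * (s * v + i) ≈ e * (s * (d * v) + i * d)
          expand = solve 5 (λ d e s v i → d :* e :* (s :* v :+ i) := e :* (s :* (d :* v) :+ i :* d)) refl
        S-rising′ : ∀ m a → S ^' m * prodFrom a m (λ i → x + ι i)
          ≈ ((α * β - γ * δ) ⁻¹) ^' m * prodFrom a m (λ i → α + β + γ + δ + ι i * ((α + γ) * (β + δ)))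
        S-rising′ zero    a = refl
        S-rising′ (suc m) a = trans (interchange _ _ _ _) (trans (*-cong (step a) (S-rising′ m (suc a))) (interchange _ _ _ _))

open import Data.Product using (_×_; _,_)

proposition8p3 : ∀ {c ℓ} (F : OrderedSqrtField c ℓ) →
    let open OrderedSqrtField F in
    (α β γ δ : Carrier) →
    0# < α → 0# < β → 0# < γ → 0# < δ → ¬ (α * β ≈ γ * δ) →
    (N r : ℕ) → r Data.Nat.≤ N →
    let open Koornwinder F α β γ δ in
    (K (suc r) (hook N r) ≈ S ^' (N ∸ r) * (ι (N C r) * prodRange r N (λ i → x + ι i)))
    × (K (suc r) (hook N r) ≈ ((α * β - γ * δ) ^' (N ∸ r)) ⁻¹
    * (ι (N C r) * prodRange r N (λ i → α + β + γ + δ + ι i * ((α + γ) * (β + δ)))))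
proposition8p3 F α β γ δ 0<α 0<β 0<γ 0<δ αβ≉γδ N r r≤N = K≈ , trans K≈ (begin
    S ^' (N ∸ r) * (ι (N C r) * prodRange r N X)             ≈⟨ x∙yz≈y∙xz _ _ _ ⟩
    ι (N C r) * (S ^' (N ∸ r) * prodRange r N X)             ≈⟨ *-congˡ (S-rising (N ∸ r) r) ⟩
    ι (N C r) * ((αβ-γδ ^' (N ∸ r)) ⁻¹ * prodRange r N G)    ≈⟨ x∙yz≈y∙xz _ _ _ ⟩
    (αβ-γδ ^' (N ∸ r)) ⁻¹ * (ι (N C r) * prodRange r N G)    ∎)
  where
  open OrderedSqrtField F
  open Koornwinder F α β γ δ
  open KoornwinderMoments F α β γ δ
  open Positive 0<α 0<β 0<γ 0<δ
  open NonDegenerate αβ≉γδ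
  open import Algebra.Properties.CommutativeSemigroup *-commutativeSemigroup using (x∙yz≈y∙xz)
  open import Relation.Binary.Reasoning.Setoid setoid
  αβ-γδ : Carrier
  αβ-γδ = α * β - γ * δ
  X G : ℕ → Carrier
  X i = x + ι i
  G i = α + β + γ + δ + ι i * ((α + γ) * (β + δ))
  K≈ : K (suc r) (hook N r) ≈ S ^' (N ∸ r) * (ι (N C r) * prodRange r N X)
  K≈ = K-hook r≤N
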